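{- Let $m\ge1$, $N$ a positive integer, and $B=[\bar b_1,\dots,\bar b_m]$ an $s\times m$ integer matrix. The set $V_m^B(N)$ is nonempty if and only if (a) the columns of $B$ sum to $\Gamma(N)$, and (b) $\bar b_1,\dots,\bar b_{m-1}\in\mathfrak{J}$ and $\bar b_m>\bar 0$.
   Context: Let $p$ be a prime, $s\ge1$. For $N=\sum_jn_jp^j$ (base $p$), $\Gamma(N)=[u_0,\dots,u_{s-1}]^t$ with $u_i=\sum_{j\equiv i\pmod s}n_j$. For a tuple $X=(X_1,\dots,X_m)$, $\Gamma X$ is the $s\times m$ matrix with columns $\Gamma(X_j)$. $V_m(N)$ is the set of $m$-tuples of positive integers summing to $N$ with no carryover of $p$-adic digits in the sum and with $(p^s-1)\mid X_j$ for $1\le j\le m-1$; $V_m^B(N):=\{X\in V_m(N):\Gamma X=B\}$. $\mathfrak{J}:=\{\Gamma(k): k\text{ a positive multiple of }p^s-1\}$. For vectors, $\bar x\le\bar y$ means $x_i\le y_i$ for all $i$, and $\bar x<\bar y$ means $\bar x\le\bar y$ and $\bar x\ne\bar y$. -}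

module Defs where

open import Data.Nat using (ℕ; zero; suc; _+_; _∸_; _^_; _<_; _≤_)
open import Data.Nat.DivMod using (_/_; _%_)
open import Data.Nat.Divisibility using (_∣_)
open import Data.Fin using (Fin; toℕ; inject₁; fromℕ)
open import Data.Integer using (ℤ; +_; 0ℤ) renaming (_+_ to _+ℤ_; _≤_ to _≤ℤ_)
open import Data.Product using (_×_; ∃)
open import Relation.Binary.PropositionalEquality using (_≡_)
open import Relation.Nullary using (¬_)
open import Data.Bool using (if_then_else_)
open import Relation.Nullary.Decidable using (⌊_⌋)
open import Data.Nat using (_≟_)

sumFin : ∀ {n} → (Fin n → ℕ) → ℕ
sumFin {zero}  f = 0
sumFin {suc n} f = f Data.Fin.zero + sumFin (λ i → f (Data.Fin.suc i))

sumFinℤ : ∀ {n} → (Fin n → ℤ) → ℤ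
sumFinℤ {zero}  f = 0ℤ
sumFinℤ {suc n} f = f Data.Fin.zero +ℤ sumFinℤ (λ i → f (Data.Fin.suc i))

sumTo : ℕ → (ℕ → ℕ) → ℕ
sumTo zero    f = 0
sumTo (suc n) f = sumTo n f + f n

-- digit p j N = j-th base-p digit n_j of N  (p = 0 is a junk case; p is prime in use)
digit : (p j N : ℕ) → ℕ
digit zero    _       _ = 0
digit (suc q) zero    N = N % suc q
digit (suc q) (suc j) N = digit (suc q) j (N / suc q)

-- Γ(N) = [u_0,…,u_{s-1}], u_i = Σ_{j ≡ i (mod s)} n_j.
-- Digits n_j with j > N vanish (p ≥ 2 ⇒ p^j > N), so summing over j ≤ N is the full sum.
Γ : (p s N : ℕ) → Fin s → ℕ
Γ p zero    N ()
Γ p (suc t) N i =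
  sumTo (suc N) (λ j → if ⌊ j % suc t ≟ toℕ i ⌋ then digit p j N else 0)

NoCarry : (p : ℕ) {m : ℕ} → (Fin m → ℕ) → Set
NoCarry p X = ∀ (j : ℕ) → sumFin (λ k → digit p j (X k)) < p

-- V_m(N) with m = suc n
InV : (p s n N : ℕ) → (Fin (suc n) → ℕ) → Set
InV p s n N X =
  (∀ k → 0 < X k) × (sumFin X ≡ N) × NoCarry p X ×
  (∀ (k : Fin n) → (p ^ s ∸ 1) ∣ X (inject₁ k))

-- ΓX = B  (B is s × m with integer entries, B i k = i-th entry of column k)
ΓMatEq : (p s : ℕ) {m : ℕ} → (Fin m → ℕ) → (Fin s → Fin m → ℤ) → Set
ΓMatEq p s X B = ∀ i k → B i k ≡ + Γ p s (X k) i

InVB : (p s n N : ℕ) → (Fin s → Fin (suc n) → ℤ) → (Fin (suc n) → ℕ) → Set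
InVB p s n N B X = InV p s n N X × ΓMatEq p s X B

InJ : (p s : ℕ) → (Fin s → ℤ) → Set
InJ p s b = ∃ λ k → (0 < k) × ((p ^ s ∸ 1) ∣ k) × (∀ i → b i ≡ + Γ p s k i)

VecPos : ∀ {s} → (Fin s → ℤ) → Set
VecPos b = (∀ i → 0ℤ ≤ℤ b i) × ¬ (∀ i → b i ≡ 0ℤ)

{-# OPTIONS --safe #-}
-- Without carries, the base-p digits of X₁ + ⋯ + X_m are the sums of the digits of the X_k, so
-- Γ is additive over the columns. Since p ^ j ≡ p ^ (j mod s) modulo p ^ s − 1, the vector Γ X
-- determines X modulo p ^ s − 1, so a summand whose column lies in 𝔍 is divisible by p ^ s − 1.
-- Conversely, for each residue class i mod s, distribute the digits of N in positions ≡ i among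
-- the m summands so that summand k receives the total B i k (a nonnegative integer matrix with
-- prescribed row and column sums exists as soon as the totals agree). Reassembling the digits
-- gives carry-free summands of N with Γ X = B, positive because every column of B is nonzero.
module Submission where

open import Defs
open import Data.Bool using (true; false; if_then_else_)
open import Data.Bool.Properties using (if-cong-then; if-eta)
open import Data.Fin using (Fin; toℕ; inject₁; fromℕ; fromℕ<) renaming (zero to fzero; suc to fsuc)
open import Data.Fin.Properties using (toℕ-fromℕ<; toℕ-injective)
  renaming (suc-injective to fsuc-injective; _≟_ to _≟ᶠ_)
open import Data.Integer using (ℤ; +_; 0ℤ; +≤+) renaming (_+_ to _+ℤ_; _≤_ to _≤ℤ_; ∣_∣ to abs)
import Data.Integer.Properties as ℤ
open import Data.Nat
open import Data.Nat.DivMod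
open import Data.Nat.Divisibility using (_∣_; divides-refl; m%n≡0⇒n∣m; n∣m⇒m%n≡0)
open import Data.Nat.Primality using (Prime; ¬prime[0]; ¬prime[1])
open import Data.Nat.Properties
open import Algebra.Properties.CommutativeSemigroup +-commutativeSemigroup using (interchange)
open import Data.Product using (_×_; _,_; proj₁; proj₂; ∃)
open import Data.Sum using (_⊎_; inj₁; inj₂)
open import Data.Vec.Functional using (_∷_)
open import Function using (_∘_)
open import Function.Bundles using (_⇔_; mk⇔)
open import Relation.Binary.PropositionalEquality
open import Relation.Nullary using (¬_; Dec; yes; no; contradiction)
open import Relation.Nullary.Decidable using (⌊_⌋)

open ≡-Reasoning

if-yes : ∀ {a b} {A : Set a} {B : Set b} (a? : Dec A) {x y : B} → A → (if ⌊ a? ⌋ then x else y) ≡ x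
if-yes (yes _) _ = refl
if-yes (no ¬a) a = contradiction a ¬a

if-no : ∀ {a b} {A : Set a} {B : Set b} (a? : Dec A) {x y : B} → ¬ A → (if ⌊ a? ⌋ then x else y) ≡ y
if-no (yes a) ¬a = contradiction a ¬a
if-no (no _)  _  = refl

sumFin-cong : ∀ {m} {f g : Fin m → ℕ} → (∀ k → f k ≡ g k) → sumFin f ≡ sumFin g
sumFin-cong {zero}  f≗g = refl
sumFin-cong {suc m} f≗g = cong₂ _+_ (f≗g fzero) (sumFin-cong (f≗g ∘ fsuc))

sumFin-zero : ∀ m → sumFin {m} (λ _ → 0) ≡ 0
sumFin-zero zero    = refl
sumFin-zero (suc m) = sumFin-zero m

sumFin-+ : ∀ {m} (f g : Fin m → ℕ) → sumFin (λ k → f k + g k) ≡ sumFin f + sumFin g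
sumFin-+ {zero}  f g = refl
sumFin-+ {suc m} f g = trans (cong (_+_ (f fzero + g fzero)) (sumFin-+ (f ∘ fsuc) (g ∘ fsuc)))
                             (interchange (f fzero) (g fzero) _ _)

sumFin-*ʳ : ∀ {m} (f : Fin m → ℕ) c → sumFin (λ k → f k * c) ≡ sumFin f * c
sumFin-*ʳ {zero}  f c = refl
sumFin-*ʳ {suc m} f c = trans (cong (_+_ (f fzero * c)) (sumFin-*ʳ (f ∘ fsuc) c))
                              (sym (*-distribʳ-+ c (f fzero) _))

sumFin-if : ∀ {m} b (f : Fin m → ℕ) → sumFin (λ k → if b then f k else 0) ≡ (if b then sumFin f else 0)
sumFin-if {m} false f = sumFin-zero m
sumFin-if     true  f = refl

sumFin-single : ∀ {m} (f : Fin m → ℕ) i → (∀ k → k ≢ i → f k ≡ 0) → sumFin f ≡ f i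
sumFin-single {suc m} f fzero    off = begin
  f fzero + sumFin (f ∘ fsuc)     ≡⟨ cong (_+_ (f fzero)) (sumFin-cong (λ k → off (fsuc k) λ ())) ⟩
  f fzero + sumFin {m} (λ _ → 0)  ≡⟨ cong (_+_ (f fzero)) (sumFin-zero m) ⟩
  f fzero + 0                     ≡⟨ +-identityʳ (f fzero) ⟩
  f fzero                         ∎
sumFin-single {suc m} f (fsuc i) off =
  cong₂ _+_ (off fzero λ ()) (sumFin-single (f ∘ fsuc) i (λ k k≢i → off (fsuc k) (k≢i ∘ fsuc-injective)))

term≤sumFin : ∀ {m} (f : Fin m → ℕ) k → f k ≤ sumFin f
term≤sumFin f fzero    = m≤m+n _ _
term≤sumFin f (fsuc k) = ≤-trans (term≤sumFin (f ∘ fsuc) k) (m≤n+m _ _)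

sumFinℤ-cong : ∀ {m} {f g : Fin m → ℤ} → (∀ k → f k ≡ g k) → sumFinℤ f ≡ sumFinℤ g
sumFinℤ-cong {zero}  f≗g = refl
sumFinℤ-cong {suc m} f≗g = cong₂ _+ℤ_ (f≗g fzero) (sumFinℤ-cong (f≗g ∘ fsuc))

sumFinℤ-+ : ∀ {m} (f : Fin m → ℕ) → sumFinℤ (λ k → + f k) ≡ + sumFin f
sumFinℤ-+ {zero}  f = refl
sumFinℤ-+ {suc m} f = trans (cong (_+ℤ_ (+ f fzero)) (sumFinℤ-+ (f ∘ fsuc))) (sym (ℤ.pos-+ (f fzero) _))

sumTo-cong : ∀ L {f g : ℕ → ℕ} → (∀ j → j < L → f j ≡ g j) → sumTo L f ≡ sumTo L g
sumTo-cong zero    f≗g = refl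
sumTo-cong (suc L) f≗g = cong₂ _+_ (sumTo-cong L (λ j j<L → f≗g j (m<n⇒m<1+n j<L))) (f≗g L ≤-refl)

sumTo-vanishing-tail : ∀ {A A′} {f : ℕ → ℕ} → (∀ j → A ≤ j → f j ≡ 0) → A ≤ A′ →
                       sumTo A′ f ≡ sumTo A f
sumTo-vanishing-tail {A} {f = f} tail A≤A′ = go (≤⇒≤′ A≤A′)
  where
  go : ∀ {A′} → A ≤′ A′ → sumTo A′ f ≡ sumTo A f
  go ≤′-refl                  = refl
  go {suc A′} (≤′-step A≤′A′) =
    trans (cong₂ _+_ (go A≤′A′) (tail A′ (≤′⇒≤ A≤′A′))) (+-identityʳ _)

sumTo-shift : ∀ L (f : ℕ → ℕ) → sumTo (suc L) f ≡ f 0 + sumTo L (f ∘ suc)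
sumTo-shift zero    f = +-comm 0 (f 0)
sumTo-shift (suc L) f = trans (cong (_+ f (suc L)) (sumTo-shift L f)) (+-assoc (f 0) _ _)

sumTo-*ʳ : ∀ L (f : ℕ → ℕ) c → sumTo L (λ j → f j * c) ≡ sumTo L f * c
sumTo-*ʳ zero    f c = refl
sumTo-*ʳ (suc L) f c = trans (cong (_+ f L * c) (sumTo-*ʳ L f c)) (sym (*-distribʳ-+ c (sumTo L f) (f L)))

sumTo-sumFin-comm : ∀ L {m} (f : Fin m → ℕ → ℕ) →
                    sumTo L (λ j → sumFin (λ k → f k j)) ≡ sumFin (λ k → sumTo L (f k))
sumTo-sumFin-comm zero    {m} f = sym (sumFin-zero m)
sumTo-sumFin-comm (suc L)     f = trans (cong (_+ sumFin (λ k → f k L)) (sumTo-sumFin-comm L f))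
                                        (sym (sumFin-+ (λ k → sumTo L (f k)) (λ k → f k L)))

term≤sumTo : ∀ L (f : ℕ → ℕ) {j} → j < L → f j ≤ sumTo L f
term≤sumTo L f j<L = go (≤⇒≤′ j<L)
  where
  go : ∀ {L j} → suc j ≤′ L → f j ≤ sumTo L f
  go ≤′-refl         = m≤n+m _ _
  go (≤′-step j<′L) = ≤-trans (go j<′L) (m≤m+n _ _)

module _ {d : ℕ} .{{_ : NonZero d}} where

  sumTo-%-cong : ∀ L {f g : ℕ → ℕ} → (∀ j → f j % d ≡ g j % d) → sumTo L f % d ≡ sumTo L g % d
  sumTo-%-cong zero    f≡g = refl
  sumTo-%-cong (suc L) {f} {g} f≡g = begin
    (sumTo L f + f L) % d               ≡⟨ %-distribˡ-+ (sumTo L f) (f L) d ⟩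
    (sumTo L f % d + f L % d) % d       ≡⟨ cong₂ (λ x y → (x + y) % d) (sumTo-%-cong L f≡g) (f≡g L) ⟩
    (sumTo L g % d + g L % d) % d       ≡⟨ %-distribˡ-+ (sumTo L g) (g L) d ⟨
    (sumTo L g + g L) % d               ∎

  [1+d]^k%d≡1%d : ∀ k → suc d ^ k % d ≡ 1 % d
  [1+d]^k%d≡1%d zero    = refl
  [1+d]^k%d≡1%d (suc k) = begin
    (suc d ^ k + d * suc d ^ k) % d ≡⟨ cong (λ x → (suc d ^ k + x) % d) (*-comm d (suc d ^ k)) ⟩
    (suc d ^ k + suc d ^ k * d) % d ≡⟨ [m+kn]%n≡m%n (suc d ^ k) (suc d ^ k) d ⟩
    suc d ^ k % d                   ≡⟨ [1+d]^k%d≡1%d k ⟩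
    1 % d                           ∎

  [a*b]%d≡a%d : ∀ a b → b % d ≡ 1 % d → a * b % d ≡ a % d
  [a*b]%d≡a%d a b b≡1 = begin
    a * b % d                 ≡⟨ %-distribˡ-* a b d ⟩
    (a % d) * (b % d) % d     ≡⟨ cong (λ x → (a % d) * x % d) b≡1 ⟩
    (a % d) * (1 % d) % d     ≡⟨ %-distribˡ-* a 1 d ⟨
    a * 1 % d                 ≡⟨ cong (_% d) (*-identityʳ a) ⟩
    a % d                     ∎

  ^-%-periodic : ∀ {a s} .{{_ : NonZero s}} → a ^ s ≡ suc d → ∀ x j → x * a ^ j % d ≡ x * a ^ (j % s) % d
  ^-%-periodic {a} {s} a^s≡1+d x j = begin
    x * a ^ j % d                                   ≡⟨ cong (λ e → x * a ^ e % d) (m≡m%n+[m/n]*n j s) ⟩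
    x * a ^ (j % s + j / s * s) % d                 ≡⟨ cong (_% d) split ⟩
    x * a ^ (j % s) * suc d ^ (j / s) % d           ≡⟨ [a*b]%d≡a%d (x * a ^ (j % s)) _ ([1+d]^k%d≡1%d (j / s)) ⟩
    x * a ^ (j % s) % d                             ∎
    where
    split : x * a ^ (j % s + j / s * s) ≡ x * a ^ (j % s) * suc d ^ (j / s)
    split = begin
      x * a ^ (j % s + j / s * s)       ≡⟨ cong (x *_) (^-distribˡ-+-* a (j % s) (j / s * s)) ⟩
      x * (a ^ (j % s) * a ^ (j / s * s)) ≡⟨ *-assoc x _ _ ⟨
      x * a ^ (j % s) * a ^ (j / s * s) ≡⟨ cong (λ e → x * a ^ (j % s) * a ^ e) (*-comm (j / s) s) ⟩
      x * a ^ (j % s) * a ^ (s * (j / s)) ≡⟨ cong (x * a ^ (j % s) *_) (^-*-assoc a s (j / s)) ⟨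
      x * a ^ (j % s) * (a ^ s) ^ (j / s) ≡⟨ cong (λ b → x * a ^ (j % s) * b ^ (j / s)) a^s≡1+d ⟩
      x * a ^ (j % s) * suc d ^ (j / s) ∎

∃-≤-with-sum : ∀ {m} (b : Fin m → ℕ) t → t ≤ sumFin b →
               ∃ λ c → (∀ k → c k ≤ b k) × sumFin c ≡ t
∃-≤-with-sum {zero}  b _ z≤n = (λ ()) , (λ ()) , refl
∃-≤-with-sum {suc m} b t t≤Σb
  with ∃-≤-with-sum (b ∘ fsuc) (t ∸ b fzero) (m≤n+o⇒m∸n≤o t (b fzero) t≤Σb)
... | c , c≤b , Σc = (b fzero ⊓ t) ∷ c
                   , (λ { fzero → m⊓n≤m (b fzero) t ; (fsuc k) → c≤b k })
                   , trans (cong (_+_ (b fzero ⊓ t)) Σc) (m⊓n+n∸m≡n (b fzero) t)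

inject₁-or-fromℕ : ∀ n (k : Fin (suc n)) → (∃ λ k′ → inject₁ k′ ≡ k) ⊎ fromℕ n ≡ k
inject₁-or-fromℕ zero    fzero    = inj₂ refl
inject₁-or-fromℕ (suc n) fzero    = inj₁ (fzero , refl)
inject₁-or-fromℕ (suc n) (fsuc k) with inject₁-or-fromℕ n k
... | inj₁ (k′ , refl) = inj₁ (fsuc k′ , refl)
... | inj₂ refl        = inj₂ refl

MatrixWithMargins : ∀ {m} → ℕ → (ℕ → ℕ) → (Fin m → ℕ) → Set
MatrixWithMargins {m} L r c = ∃ λ (e : Fin m → ℕ → ℕ) →
  (∀ j → j < L → sumFin (λ k → e k j) ≡ r j) × (∀ k → sumTo L (e k) ≡ c k)

prepend-row : ∀ {m L} {r : ℕ → ℕ} {c c₀ : Fin m → ℕ} → (∀ k → c₀ k ≤ c k) → sumFin c₀ ≡ r 0 →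
              MatrixWithMargins L (r ∘ suc) (λ k → c k ∸ c₀ k) → MatrixWithMargins (suc L) r c
prepend-row {L = L} {r} {c} {c₀} c₀≤c Σc₀ (e , rows , cols) = e⁺ , rows⁺ , cols⁺
  where
  e⁺ : _ → ℕ → ℕ
  e⁺ k zero    = c₀ k
  e⁺ k (suc j) = e k j
  rows⁺ : ∀ j → j < suc L → sumFin (λ k → e⁺ k j) ≡ r j
  rows⁺ zero    _       = Σc₀
  rows⁺ (suc j) 1+j<1+L = rows j (s≤s⁻¹ 1+j<1+L)
  cols⁺ : ∀ k → sumTo (suc L) (e⁺ k) ≡ c k
  cols⁺ k = trans (sumTo-shift L (e⁺ k)) (trans (cong (_+_ (c₀ k)) (cols k)) (m+[n∸m]≡n (c₀≤c k)))

∃-matrix-with-margins : ∀ {m} L (r : ℕ → ℕ) (c : Fin m → ℕ) → sumFin c ≡ sumTo L r →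
                        MatrixWithMargins L r c
∃-matrix-with-margins zero r c Σc≡0 =
  (λ _ _ → 0) , (λ _ ()) , (λ k → sym (n≤0⇒n≡0 (subst (c k ≤_) Σc≡0 (term≤sumFin c k))))
∃-matrix-with-margins (suc L) r c Σc≡Σr =
  let c₀ , c₀≤c , Σc₀ = ∃-≤-with-sum c (r 0) (subst (r 0 ≤_) (sym Σc≡r₀+Σr′) (m≤m+n (r 0) _))
  in prepend-row c₀≤c Σc₀ (∃-matrix-with-margins L (r ∘ suc) (λ k → c k ∸ c₀ k) (Σrest c₀≤c Σc₀))
  where
  Σc≡r₀+Σr′ : sumFin c ≡ r 0 + sumTo L (r ∘ suc)
  Σc≡r₀+Σr′ = trans Σc≡Σr (sumTo-shift L r)
  Σrest : ∀ {c₀} → (∀ k → c₀ k ≤ c k) → sumFin c₀ ≡ r 0 →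
          sumFin (λ k → c k ∸ c₀ k) ≡ sumTo L (r ∘ suc)
  Σrest {c₀} c₀≤c Σc₀ = +-cancelʳ-≡ (r 0) _ _ (begin
    sumFin (λ k → c k ∸ c₀ k) + r 0        ≡⟨ cong (_+_ (sumFin (λ k → c k ∸ c₀ k))) Σc₀ ⟨
    sumFin (λ k → c k ∸ c₀ k) + sumFin c₀  ≡⟨ sumFin-+ (λ k → c k ∸ c₀ k) c₀ ⟨
    sumFin (λ k → c k ∸ c₀ k + c₀ k)       ≡⟨ sumFin-cong (λ k → m∸n+n≡m (c₀≤c k)) ⟩
    sumFin c                               ≡⟨ Σc≡r₀+Σr′ ⟩
    r 0 + sumTo L (r ∘ suc)                ≡⟨ +-comm (r 0) _ ⟩
    sumTo L (r ∘ suc) + r 0                ∎)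

module Digits (q : ℕ) where

  -- Writing the base as 2 + q lets digit p compute by its defining clauses.
  p : ℕ
  p = 2 + q

  digit<p : ∀ j N → digit p j N < p
  digit<p zero    N = m%n<n N p
  digit<p (suc j) N = digit<p j (N / p)

  digit-zero : ∀ j → digit p j 0 ≡ 0
  digit-zero zero    = refl
  digit-zero (suc j) = digit-zero j

  digit-vanishes : ∀ {j} N → N < j → digit p j N ≡ 0
  digit-vanishes {suc j} zero        _     = digit-zero (suc j)
  digit-vanishes {suc j} N@(suc _) N<1+j =
    digit-vanishes (N / p) (<-≤-trans (m/n<m N p (s≤s (s≤s z≤n))) (s≤s⁻¹ N<1+j))

  [a+b*p]%p≡a : ∀ {a} b → a < p → (a + b * p) % p ≡ a
  [a+b*p]%p≡a {a} b a<p = trans ([m+kn]%n≡m%n a b p) (m<n⇒m%n≡m a<p)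

  [a+b*p]/p≡b : ∀ {a} b → a < p → (a + b * p) / p ≡ b
  [a+b*p]/p≡b {a} b a<p = trans (+-distrib-/-∣ʳ a (divides-refl b)) (cong₂ _+_ (m<n⇒m/n≡0 a<p) (m*n/n≡m b p))

  fromDigits : ℕ → (ℕ → ℕ) → ℕ
  fromDigits zero    d = 0
  fromDigits (suc L) d = d 0 + fromDigits L (d ∘ suc) * p

  fromDigits-cong : ∀ L {d d′ : ℕ → ℕ} → (∀ j → j < L → d j ≡ d′ j) →
                    fromDigits L d ≡ fromDigits L d′
  fromDigits-cong zero    d≗d′ = refl
  fromDigits-cong (suc L) d≗d′ =
    cong₂ (λ x y → x + y * p) (d≗d′ 0 z<s) (fromDigits-cong L (λ j j<L → d≗d′ (suc j) (s≤s j<L)))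

  fromDigits-zero : ∀ L → fromDigits L (λ _ → 0) ≡ 0
  fromDigits-zero zero    = refl
  fromDigits-zero (suc L) = cong (_* p) (fromDigits-zero L)

  fromDigits-digits : ∀ L N → N ≤ L → fromDigits L (λ j → digit p j N) ≡ N
  fromDigits-digits zero    _ z≤n   = refl
  fromDigits-digits (suc L) N N≤1+L = begin
    N % p + fromDigits L (λ j → digit p j (N / p)) * p
      ≡⟨ cong (λ x → N % p + x * p) (fromDigits-digits L (N / p) (N/p≤L N N≤1+L)) ⟩
    N % p + N / p * p
      ≡⟨ m≡m%n+[m/n]*n N p ⟨
    N
      ∎
    where
    N/p≤L : ∀ N → N ≤ suc L → N / p ≤ L
    N/p≤L zero        _     = z≤n
    N/p≤L N@(suc _) N≤1+L = s≤s⁻¹ (<-≤-trans (m/n<m N p (s≤s (s≤s z≤n))) N≤1+L)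

  digits-zero⇒zero : ∀ N → (∀ j → j ≤ N → digit p j N ≡ 0) → N ≡ 0
  digits-zero⇒zero N zeros = begin
    N                                      ≡⟨ fromDigits-digits (suc N) N (n≤1+n N) ⟨
    fromDigits (suc N) (λ j → digit p j N) ≡⟨ fromDigits-cong (suc N) (λ j j<1+N → zeros j (s≤s⁻¹ j<1+N)) ⟩
    fromDigits (suc N) (λ _ → 0)           ≡⟨ fromDigits-zero (suc N) ⟩
    0                                      ∎

  DigitSequence : ℕ → (ℕ → ℕ) → Set
  DigitSequence L d = ∀ j → j < L → d j < p

  DigitSequence-tail : ∀ {L d} → DigitSequence (suc L) d → DigitSequence L (d ∘ suc)
  DigitSequence-tail d<p j j<L = d<p (suc j) (s≤s j<L)

  digit-fromDigits : ∀ L {d} → DigitSequence L d → ∀ {j} → j < L → digit p j (fromDigits L d) ≡ d j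
  digit-fromDigits (suc L) {d} d<p {zero}  _       = [a+b*p]%p≡a (fromDigits L (d ∘ suc)) (d<p 0 z<s)
  digit-fromDigits (suc L) {d} d<p {suc j} 1+j<1+L = begin
    digit p j ((d 0 + fromDigits L (d ∘ suc) * p) / p)
      ≡⟨ cong (digit p j) ([a+b*p]/p≡b _ (d<p 0 z<s)) ⟩
    digit p j (fromDigits L (d ∘ suc))
      ≡⟨ digit-fromDigits L (DigitSequence-tail d<p) (s≤s⁻¹ 1+j<1+L) ⟩
    d (suc j)                                          ∎

  digit-fromDigits-≥ : ∀ L {d} → DigitSequence L d → ∀ {j} → L ≤ j → digit p j (fromDigits L d) ≡ 0
  digit-fromDigits-≥ zero            _   {j}     _       = digit-zero j
  digit-fromDigits-≥ (suc L) {d} d<p {suc j} 1+L≤1+j = begin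
    digit p j ((d 0 + fromDigits L (d ∘ suc) * p) / p)
      ≡⟨ cong (digit p j) ([a+b*p]/p≡b _ (d<p 0 z<s)) ⟩
    digit p j (fromDigits L (d ∘ suc))
      ≡⟨ digit-fromDigits-≥ L (DigitSequence-tail d<p) (s≤s⁻¹ 1+L≤1+j) ⟩
    0                                                  ∎

  fromDigits-sumFin : ∀ L {m} (d : Fin m → ℕ → ℕ) →
                      fromDigits L (λ j → sumFin (λ k → d k j)) ≡ sumFin (λ k → fromDigits L (d k))
  fromDigits-sumFin zero    {m} d = sym (sumFin-zero m)
  fromDigits-sumFin (suc L)     d = begin
    sumFin (λ k → d k 0) + fromDigits L (λ j → sumFin (λ k → d k (suc j))) * p
      ≡⟨ cong (λ x → sumFin (λ k → d k 0) + x * p) (fromDigits-sumFin L (λ k → d k ∘ suc)) ⟩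
    sumFin (λ k → d k 0) + sumFin (λ k → fromDigits L (d k ∘ suc)) * p
      ≡⟨ cong (_+_ (sumFin (λ k → d k 0))) (sumFin-*ʳ (λ k → fromDigits L (d k ∘ suc)) p) ⟨
    sumFin (λ k → d k 0) + sumFin (λ k → fromDigits L (d k ∘ suc) * p)
      ≡⟨ sumFin-+ (λ k → d k 0) (λ k → fromDigits L (d k ∘ suc) * p) ⟨
    sumFin (λ k → d k 0 + fromDigits L (d k ∘ suc) * p)
      ∎

  fromDigits-sumTo : ∀ L d → fromDigits L d ≡ sumTo L (λ j → d j * p ^ j)
  fromDigits-sumTo zero    d = refl
  fromDigits-sumTo (suc L) d = begin
    d 0 + fromDigits L (d ∘ suc) * p                ≡⟨ cong (λ x → d 0 + x * p) (fromDigits-sumTo L (d ∘ suc)) ⟩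
    d 0 + sumTo L (λ j → d (suc j) * p ^ j) * p     ≡⟨ cong₂ _+_ (*-identityʳ (d 0)) (sumTo-*ʳ L _ p) ⟨
    d 0 * 1 + sumTo L (λ j → d (suc j) * p ^ j * p) ≡⟨ cong (_+_ (d 0 * 1)) (sumTo-cong L (λ j _ → shift j)) ⟩
    d 0 * 1 + sumTo L (λ j → d (suc j) * p ^ suc j) ≡⟨ sumTo-shift L (λ j → d j * p ^ j) ⟨
    sumTo (suc L) (λ j → d j * p ^ j)               ∎
    where
    shift : ∀ j → d (suc j) * p ^ j * p ≡ d (suc j) * p ^ suc j
    shift j = trans (*-assoc (d (suc j)) (p ^ j) p) (cong (d (suc j) *_) (*-comm (p ^ j) p))

  sumFin-divMod : ∀ {m} (X : Fin m → ℕ) → sumFin X ≡ sumFin (λ k → X k % p) + sumFin (λ k → X k / p) * p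
  sumFin-divMod X = begin
    sumFin X                                            ≡⟨ sumFin-cong (λ k → m≡m%n+[m/n]*n (X k) p) ⟩
    sumFin (λ k → X k % p + X k / p * p)                ≡⟨ sumFin-+ (λ k → X k % p) (λ k → X k / p * p) ⟩
    sumFin (λ k → X k % p) + sumFin (λ k → X k / p * p) ≡⟨ cong (_+_ Σ%) (sumFin-*ʳ (λ k → X k / p) p) ⟩
    Σ% + sumFin (λ k → X k / p) * p                     ∎
    where Σ% = sumFin (λ k → X k % p)

  digit-sumFin : ∀ j {m} (X : Fin m → ℕ) → NoCarry p X →
                 digit p j (sumFin X) ≡ sumFin (λ k → digit p j (X k))
  digit-sumFin zero    X noCarry =
    trans (cong (_% p) (sumFin-divMod X)) ([a+b*p]%p≡a (sumFin (λ k → X k / p)) (noCarry 0))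
  digit-sumFin (suc j) X noCarry = begin
    digit p j (sumFin X / p)
      ≡⟨ cong (λ x → digit p j (x / p)) (sumFin-divMod X) ⟩
    digit p j ((sumFin (λ k → X k % p) + sumFin (λ k → X k / p) * p) / p)
      ≡⟨ cong (digit p j) ([a+b*p]/p≡b _ (noCarry 0)) ⟩
    digit p j (sumFin (λ k → X k / p))
      ≡⟨ digit-sumFin j (λ k → X k / p) (noCarry ∘ suc) ⟩
    sumFin (λ k → digit p j (X k / p))
      ∎

  module DigitSplit {m} (N L : ℕ) (N≤L : N ≤ L) (d : Fin m → ℕ → ℕ)
                    (d-sum : ∀ j → j < L → sumFin (λ k → d k j) ≡ digit p j N) where

    d<p : ∀ k → DigitSequence L (d k)
    d<p k j j<L = ≤-<-trans (term≤sumFin (λ k → d k j) k) (subst (_< p) (sym (d-sum j j<L)) (digit<p j N))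

    parts : Fin m → ℕ
    parts k = fromDigits L (d k)

    digit-parts : ∀ k {j} → j < L → digit p j (parts k) ≡ d k j
    digit-parts k = digit-fromDigits L (d<p k)

    digit-parts-≥ : ∀ k {j} → L ≤ j → digit p j (parts k) ≡ 0
    digit-parts-≥ k = digit-fromDigits-≥ L (d<p k)

    parts-noCarry : NoCarry p parts
    parts-noCarry j with j <? L
    ... | yes j<L = subst (_< p) (sym (trans (sumFin-cong (λ k → digit-parts k j<L)) (d-sum j j<L))) (digit<p j N)
    ... | no  j≮L =
      subst (_< p) (sym (trans (sumFin-cong (λ k → digit-parts-≥ k (≮⇒≥ j≮L))) (sumFin-zero m))) z<s

    sumFin-parts : sumFin parts ≡ N
    sumFin-parts = begin
      sumFin parts                                ≡⟨ fromDigits-sumFin L d ⟨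
      fromDigits L (λ j → sumFin (λ k → d k j))   ≡⟨ fromDigits-cong L d-sum ⟩
      fromDigits L (λ j → digit p j N)            ≡⟨ fromDigits-digits L N N≤L ⟩
      N                                           ∎

  module Classes (t : ℕ) where

    s : ℕ
    s = suc t

    residue : ℕ → Fin s
    residue j = fromℕ< (m%n<n j s)

    toℕ-residue : ∀ j → toℕ (residue j) ≡ j % s
    toℕ-residue j = toℕ-fromℕ< (m%n<n j s)

    -- Γ p s X i unfolds to sumTo (suc X) (classDigit X i).
    classDigit : ℕ → Fin s → ℕ → ℕ
    classDigit X i j = if ⌊ j % s ≟ toℕ i ⌋ then digit p j X else 0

    classDigit-residue : ∀ X j → classDigit X (residue j) j ≡ digit p j X
    classDigit-residue X j =
      if-yes (j % s ≟ toℕ (residue j)) (sym (toℕ-residue j))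

    classDigit-≢ : ∀ X j {i} → i ≢ residue j → classDigit X i j ≡ 0
    classDigit-≢ X j {i} i≢ =
      if-no (j % s ≟ toℕ i) (i≢ ∘ toℕ-injective ∘ residue≡)
      where
      residue≡ : j % s ≡ toℕ i → toℕ i ≡ toℕ (residue j)
      residue≡ j%s≡i = trans (sym j%s≡i) (sym (toℕ-residue j))

    classDigit-vanishes : ∀ X i j → digit p j X ≡ 0 → classDigit X i j ≡ 0
    classDigit-vanishes X i j digit≡0 = trans (if-cong-then ⌊ j % s ≟ toℕ i ⌋ digit≡0) (if-eta _)

    Γ-sumTo : ∀ X i L → (∀ j → L ≤ j → digit p j X ≡ 0) → Γ p s X i ≡ sumTo L (classDigit X i)
    Γ-sumTo X i L high = begin
      sumTo (suc X) (classDigit X i)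
        ≡⟨ sumTo-vanishing-tail (λ j X<j → classDigit-vanishes X i j (digit-vanishes X X<j)) (m≤m+n (suc X) L) ⟨
      sumTo (suc X + L) (classDigit X i)
        ≡⟨ sumTo-vanishing-tail (λ j L≤j → classDigit-vanishes X i j (high j L≤j)) (m≤n+m L (suc X)) ⟩
      sumTo L (classDigit X i)
        ∎

    Γ-zero : ∀ i → Γ p s 0 i ≡ 0
    Γ-zero i = classDigit-vanishes 0 i 0 refl

    digit≤Γ : ∀ X {j} → j ≤ X → digit p j X ≤ Γ p s X (residue j)
    digit≤Γ X {j} j≤X =
      subst (_≤ Γ p s X (residue j)) (classDigit-residue X j) (term≤sumTo (suc X) _ (s≤s j≤X))

    Γ≢0 : ∀ {X} → 0 < X → ¬ (∀ i → Γ p s X i ≡ 0)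
    Γ≢0 {X} 0<X Γ≡0 = <⇒≢ 0<X (sym (digits-zero⇒zero X digit≡0))
      where
      digit≡0 : ∀ j → j ≤ X → digit p j X ≡ 0
      digit≡0 j j≤X = n≤0⇒n≡0 (subst (digit p j X ≤_) (Γ≡0 (residue j)) (digit≤Γ X j≤X))

    Γ-sumFin : ∀ {m} (X : Fin m → ℕ) → NoCarry p X → ∀ i →
               sumFin (λ k → Γ p s (X k) i) ≡ Γ p s (sumFin X) i
    Γ-sumFin X noCarry i = begin
      sumFin (λ k → Γ p s (X k) i)                         ≡⟨ sumFin-cong (λ k → Γ-sumTo (X k) i L (high k)) ⟩
      sumFin (λ k → sumTo L (classDigit (X k) i))          ≡⟨ sumTo-sumFin-comm L (λ k → classDigit (X k) i) ⟨
      sumTo L (λ j → sumFin (λ k → classDigit (X k) i j))  ≡⟨ sumTo-cong L (λ j _ → class-sum j) ⟩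
      sumTo L (classDigit (sumFin X) i)                    ∎
      where
      L : ℕ
      L = suc (sumFin X)
      high : ∀ k j → L ≤ j → digit p j (X k) ≡ 0
      high k j L≤j = digit-vanishes (X k) (≤-<-trans (term≤sumFin X k) L≤j)
      class-sum : ∀ j → sumFin (λ k → classDigit (X k) i j) ≡ classDigit (sumFin X) i j
      class-sum j = trans (sumFin-if ⌊ j % s ≟ toℕ i ⌋ (λ k → digit p j (X k)))
                          (cong (λ x → if ⌊ j % s ≟ toℕ i ⌋ then x else 0) (sym (digit-sumFin j X noCarry)))

    2≤p^s : 2 ≤ p ^ s
    2≤p^s = ≤-trans (s≤s (s≤s z≤n)) (m≤m*n p (p ^ t) {{m^n≢0 p t}})

    p^s∸1 : ℕ
    p^s∸1 = p ^ s ∸ 1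

    instance
      p^s∸1-nonZero : NonZero p^s∸1
      p^s∸1-nonZero = >-nonZero (∸-monoˡ-≤ 1 2≤p^s)

    p^s≡1+p^s∸1 : p ^ s ≡ suc p^s∸1
    p^s≡1+p^s∸1 = sym (m+[n∸m]≡n (≤-trans (s≤s z≤n) 2≤p^s))

    Γ-value : ℕ → ℕ
    Γ-value X = sumFin (λ i → Γ p s X i * p ^ toℕ i)

    classDigit-weights : ∀ X j → sumFin (λ i → classDigit X i j * p ^ toℕ i) ≡ digit p j X * p ^ (j % s)
    classDigit-weights X j = trans
      (sumFin-single (λ i → classDigit X i j * p ^ toℕ i) (residue j)
                     (λ i i≢ → cong (_* p ^ toℕ i) (classDigit-≢ X j i≢)))
      (cong₂ (λ x e → x * p ^ e) (classDigit-residue X j) (toℕ-residue j))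

    X%p^s∸1≡Γ-value%p^s∸1 : ∀ X → X % p^s∸1 ≡ Γ-value X % p^s∸1
    X%p^s∸1≡Γ-value%p^s∸1 X = begin
      X % p^s∸1
        ≡⟨ cong (_% p^s∸1) (fromDigits-digits (suc X) X (n≤1+n X)) ⟨
      fromDigits (suc X) (λ j → digit p j X) % p^s∸1
        ≡⟨ cong (_% p^s∸1) (fromDigits-sumTo (suc X) (λ j → digit p j X)) ⟩
      sumTo (suc X) (λ j → digit p j X * p ^ j) % p^s∸1
        ≡⟨ sumTo-%-cong (suc X) (λ j → ^-%-periodic p^s≡1+p^s∸1 (digit p j X) j) ⟩
      sumTo (suc X) (λ j → digit p j X * p ^ (j % s)) % p^s∸1
        ≡⟨ cong (_% p^s∸1) (sumTo-cong (suc X) (λ j _ → sym (classDigit-weights X j))) ⟩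
      sumTo (suc X) (λ j → sumFin (λ i → classDigit X i j * p ^ toℕ i)) % p^s∸1
        ≡⟨ cong (_% p^s∸1) (sumTo-sumFin-comm (suc X) (λ i j → classDigit X i j * p ^ toℕ i)) ⟩
      sumFin (λ i → sumTo (suc X) (λ j → classDigit X i j * p ^ toℕ i)) % p^s∸1
        ≡⟨ cong (_% p^s∸1) (sumFin-cong (λ i → sumTo-*ʳ (suc X) (classDigit X i) (p ^ toℕ i))) ⟩
      Γ-value X % p^s∸1
        ∎

    Γ-≡⇒∣ : ∀ {X Y} → (∀ i → Γ p s X i ≡ Γ p s Y i) → p^s∸1 ∣ Y → p^s∸1 ∣ X
    Γ-≡⇒∣ {X} {Y} ΓX≡ΓY p^s∸1∣Y = m%n≡0⇒n∣m X p^s∸1 (begin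
      X % p^s∸1        ≡⟨ X%p^s∸1≡Γ-value%p^s∸1 X ⟩
      Γ-value X % p^s∸1 ≡⟨ cong (_% p^s∸1) (sumFin-cong (λ i → cong (_* p ^ toℕ i) (ΓX≡ΓY i))) ⟩
      Γ-value Y % p^s∸1 ≡⟨ X%p^s∸1≡Γ-value%p^s∸1 Y ⟨
      Y % p^s∸1        ≡⟨ n∣m⇒m%n≡0 Y p^s∸1 p^s∸1∣Y ⟩
      0                ∎)

    module Realisation {m} (N : ℕ) (b : Fin s → Fin m → ℕ)
                       (b-rows : ∀ i → sumFin (b i) ≡ Γ p s N i) where

      margins : ∀ i → MatrixWithMargins (suc N) (classDigit N i) (b i)
      margins i = ∃-matrix-with-margins (suc N) (classDigit N i) (b i) (b-rows i)

      e : Fin s → Fin m → ℕ → ℕ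
      e i = proj₁ (margins i)

      e-rows : ∀ i j → j < suc N → sumFin (λ k → e i k j) ≡ classDigit N i j
      e-rows i = proj₁ (proj₂ (margins i))

      e-cols : ∀ i k → sumTo (suc N) (e i k) ≡ b i k
      e-cols i = proj₂ (proj₂ (margins i))

      e-off-class : ∀ {i} j k → i ≢ residue j → j < suc N → e i k j ≡ 0
      e-off-class {i} j k i≢ j≤N = n≤0⇒n≡0 (subst (e i k j ≤_) column-sum≡0 (term≤sumFin (λ k → e i k j) k))
        where column-sum≡0 = trans (e-rows i j j≤N) (classDigit-≢ N j i≢)

      d-sum : ∀ j → j < suc N → sumFin (λ k → e (residue j) k j) ≡ digit p j N
      d-sum j j≤N = trans (e-rows (residue j) j j≤N) (classDigit-residue N j)

      -- Part k takes, at position j, its share of the residue class of j.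
      open DigitSplit N (suc N) (n≤1+n N) (λ k j → e (residue j) k j) d-sum public

      classDigit-parts : ∀ i k {j} → j < suc N → classDigit (parts k) i j ≡ e i k j
      classDigit-parts i k {j} j≤N = by-class (i ≟ᶠ residue j)
        where
        by-class : Dec (i ≡ residue j) → classDigit (parts k) i j ≡ e i k j
        by-class (yes i≡) = subst (λ i → classDigit (parts k) i j ≡ e i k j) (sym i≡)
                                  (trans (classDigit-residue (parts k) j) (digit-parts k j≤N))
        by-class (no i≢)  = trans (classDigit-≢ (parts k) j i≢) (sym (e-off-class j k i≢ j≤N))

      Γ-parts : ∀ i k → Γ p s (parts k) i ≡ b i k
      Γ-parts i k = begin
        Γ p s (parts k) i                      ≡⟨ Γ-sumTo (parts k) i (suc N) (λ j → digit-parts-≥ k) ⟩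
        sumTo (suc N) (classDigit (parts k) i) ≡⟨ sumTo-cong (suc N) (λ j → classDigit-parts i k) ⟩
        sumTo (suc N) (e i k)                  ≡⟨ e-cols i k ⟩
        b i k                                  ∎

    Γ-VecPos : ∀ {X} {b : Fin s → ℤ} → 0 < X → (∀ i → b i ≡ + Γ p s X i) → VecPos b
    Γ-VecPos 0<X b≡Γ = (λ i → subst (0ℤ ≤ℤ_) (sym (b≡Γ i)) (+≤+ z≤n))
                     , (λ b≡0 → Γ≢0 0<X (λ i → ℤ.+-injective (trans (sym (b≡Γ i)) (b≡0 i))))

    InJ⇒VecPos : ∀ {b} → InJ p s b → VecPos b
    InJ⇒VecPos (_ , 0<k , _ , b≡Γ) = Γ-VecPos 0<k b≡Γ

    module _ (n N : ℕ) (B : Fin s → Fin (suc n) → ℤ) where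

      Conditions : Set
      Conditions = (∀ i → sumFinℤ (λ k → B i k) ≡ + Γ p s N i) ×
                   ((∀ (k : Fin n) → InJ p s (λ i → B i (inject₁ k))) × VecPos (λ i → B i (fromℕ n)))

      VB⇒conditions : ∀ {X} → InVB p s n N B X → Conditions
      VB⇒conditions {X} ((X-pos , ΣX≡N , noCarry , X-div) , B≡Γ) =
          rows
        , (λ k → X (inject₁ k) , X-pos (inject₁ k) , X-div k , (λ i → B≡Γ i (inject₁ k)))
        , Γ-VecPos (X-pos (fromℕ n)) (λ i → B≡Γ i (fromℕ n))
        where
        rows : ∀ i → sumFinℤ (λ k → B i k) ≡ + Γ p s N i
        rows i = begin
          sumFinℤ (λ k → B i k)           ≡⟨ sumFinℤ-cong (B≡Γ i) ⟩
          sumFinℤ (λ k → + Γ p s (X k) i) ≡⟨ sumFinℤ-+ (λ k → Γ p s (X k) i) ⟩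
          + sumFin (λ k → Γ p s (X k) i)  ≡⟨ cong +_ (Γ-sumFin X noCarry i) ⟩
          + Γ p s (sumFin X) i            ≡⟨ cong (λ M → + Γ p s M i) ΣX≡N ⟩
          + Γ p s N i                     ∎

      conditions⇒VB : Conditions → ∃ (InVB p s n N B)
      conditions⇒VB (rows , J , last) = parts , (parts-pos , sumFin-parts , parts-noCarry , parts-div) , B≡Γ
        where
        column-VecPos : ∀ k → VecPos (λ i → B i k)
        column-VecPos k with inject₁-or-fromℕ n k
        ... | inj₁ (k′ , refl) = InJ⇒VecPos (J k′)
        ... | inj₂ refl        = last

        b : Fin s → Fin (suc n) → ℕ
        b i k = abs (B i k)

        B≡b : ∀ i k → B i k ≡ + b i k
        B≡b i k = sym (ℤ.0≤i⇒+∣i∣≡i (proj₁ (column-VecPos k) i))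

        b-rows : ∀ i → sumFin (b i) ≡ Γ p s N i
        b-rows i = ℤ.+-injective (begin
          + sumFin (b i)          ≡⟨ sumFinℤ-+ (b i) ⟨
          sumFinℤ (λ k → + b i k) ≡⟨ sumFinℤ-cong (B≡b i) ⟨
          sumFinℤ (λ k → B i k)   ≡⟨ rows i ⟩
          + Γ p s N i             ∎)

        open Realisation N b b-rows

        B≡Γ : ∀ i k → B i k ≡ + Γ p s (parts k) i
        B≡Γ i k = trans (B≡b i k) (cong +_ (sym (Γ-parts i k)))

        parts-pos : ∀ k → 0 < parts k
        parts-pos k = n≢0⇒n>0 λ parts≡0 → proj₂ (column-VecPos k) λ i → begin
          B i k               ≡⟨ B≡Γ i k ⟩
          + Γ p s (parts k) i ≡⟨ cong (λ x → + Γ p s x i) parts≡0 ⟩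
          + Γ p s 0 i         ≡⟨ cong +_ (Γ-zero i) ⟩
          0ℤ                  ∎

        parts-div : ∀ k → p^s∸1 ∣ parts (inject₁ k)
        parts-div k = let _ , _ , p^s∸1∣k′ , J≡Γ = J k in
          Γ-≡⇒∣ (λ i → ℤ.+-injective (trans (sym (B≡Γ i (inject₁ k))) (J≡Γ i))) p^s∸1∣k′

lemma3p5 : (p s n N : ℕ) → Prime p → 1 ≤ s → 0 < N →
    (B : Fin s → Fin (suc n) → ℤ) →
    (∃ λ (X : Fin (suc n) → ℕ) → InVB p s n N B X) ⇔
      ((∀ i → sumFinℤ (λ k → B i k) ≡ + Γ p s N i) ×
       ((∀ (k : Fin n) → InJ p s (λ i → B i (inject₁ k))) × VecPos (λ i → B i (fromℕ n))))
lemma3p5 0             _       _ _ prime[0] = contradiction prime[0] ¬prime[0]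
lemma3p5 1             _       _ _ prime[1] = contradiction prime[1] ¬prime[1]
lemma3p5 (suc (suc q)) 0       _ _ _ ()
lemma3p5 (suc (suc q)) (suc t) n N _ _ _ B = mk⇔ (VB⇒conditions n N B ∘ proj₂) (conditions⇒VB n N B)
  where open Digits.Classes q t
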